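{- Let $m$ be a positive integer and $\lambda$ a nonzero real number. For integers $0\le k\le n$, $$m^{n-k}S_{1,\lambda/m}(n,k)=\sum_{i=k}^{n}\binom{i}{k}V_{m,\lambda}(n,i)\,(1)_{i-k,\lambda}.$$
   Context: For a nonzero real $\mu$: $(x)_{0,\mu}=1$, $(x)_{n,\mu}=x(x-\mu)\cdots(x-(n-1)\mu)$; $(x)_n=(x)_{n,1}$. Degenerate Stirling numbers of the first kind: $(x)_n=\sum_{l=0}^{n}S_{1,\mu}(n,l)(x)_{l,\mu}$. Degenerate Whitney numbers of the first kind $V_{m,\lambda}(n,k)$: $m^{n}(x)_{n}=\sum_{k=0}^{n}V_{m,\lambda}(n,k)(mx+1)_{k,\lambda}$. -}

module Defs where

open import Level using (Level; _⊔_) renaming (suc to lsuc)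
open import Data.Nat using (ℕ; zero; suc; _∸_; _≤_; s≤s) renaming (_+_ to _+ℕ_)
open import Data.Nat.Combinatorics using (_C_)
open import Relation.Nullary using (¬_)
open import Algebra.Bundles using (CommutativeRing; Semiring)
import Algebra.Definitions.RawSemiring as RawSemiringDefs

record CharZeroField (c ℓ : Level) : Set (lsuc (c ⊔ ℓ)) where
  field
    commutativeRing : CommutativeRing c ℓ
  open CommutativeRing commutativeRing public
  open RawSemiringDefs (Semiring.rawSemiring semiring) public using (_×_; _^_)
  field
    1≉0     : ¬ (1# ≈ 0#)
    inverse : (x : Carrier) → ¬ (x ≈ 0#) → Carrier
    inverseʳ : (x : Carrier) (x≉0 : ¬ (x ≈ 0#)) → x * inverse x x≉0 ≈ 1#
    char0   : (n : ℕ) → ¬ (suc n × 1# ≈ 0#)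

module Ops {c ℓ : Level} (F : CharZeroField c ℓ) where
  open CharZeroField F

  ι : ℕ → Carrier
  ι n = n × 1#

  ι-nonzero : (m : ℕ) → 1 ≤ m → ¬ (ι m ≈ 0#)
  ι-nonzero (suc m) (s≤s _) = char0 m

  divBy : Carrier → (m : ℕ) → 1 ≤ m → Carrier
  divBy μ m hm = μ * inverse (ι m) (ι-nonzero m hm)

  -- degenerate falling factorial (x)_{n,μ} = x(x-μ)...(x-(n-1)μ)
  fall : Carrier → ℕ → Carrier → Carrier
  fall x zero    μ = 1#
  fall x (suc n) μ = fall x n μ * (x - n × μ)

  sumTo : ℕ → (ℕ → Carrier) → Carrier
  sumTo zero    f = f 0
  sumTo (suc n) f = sumTo n f + f (suc n)

  sumFromTo : ℕ → ℕ → (ℕ → Carrier) → Carrier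
  sumFromTo k n f = sumTo (n ∸ k) (λ j → f (k +ℕ j))

  binom : ℕ → ℕ → Carrier
  binom i k = ι (i C k)

-- Write μ = λ/m and expand m^n (x)_n in the basis (x)_{k,μ} in two ways. The
-- defining relation of S gives the coefficients m^n S(n,k) directly. The
-- defining relation of V gives Σ_i V(n,i) (mx+1)_{i,λ}; expanding each
-- (mx+1)_{i,λ} by the degenerate binomial theorem and using
-- (mx)_{k,λ} = m^k (x)_{k,μ} yields the coefficients
-- m^k Σ_i C(i,k) V(n,i) (1)_{i-k,λ}. Since μ ≠ 0, the polynomials (x)_{k,μ}
-- are linearly independent (evaluate at x = jμ, where (x)_{k,μ} vanishes for
-- k > j and not for k = j), so the coefficients agree; cancelling m^k gives
-- the identity.
module Submission where

open import Defs
open import Level using (Level)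
open import Data.Nat as ℕ using (ℕ; zero; suc; _∸_; _≤_; _<_; z≤n; s≤s)
import Data.Nat.Properties as ℕ
open import Data.Nat.Induction using (<-rec)
open import Data.Nat.Combinatorics
  using (_C_; k>n⇒nCk≡0; nCk+nC[k+1]≡[n+1]C[k+1]; nCk≡nC[n∸k]; nCn≡1)
open import Data.Sum using (inj₁; inj₂)
open import Data.Empty using (⊥-elim)
open import Relation.Nullary using (¬_; yes; no)
open import Relation.Binary.Definitions using (tri<; tri≈; tri>)
open import Relation.Binary.PropositionalEquality as ≡ using (_≢_)
import Algebra.Solver.CommutativeMonoid as CommutativeMonoidSolver

module Development {c ℓ : Level} (F : CharZeroField c ℓ) where
  open CharZeroField F hiding (zero)
  open Ops F
  open import Relation.Binary.Reasoning.Setoid setoid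
  open import Algebra.Properties.Ring ring using (-‿distribˡ-*; -‿distribʳ-*; -‿+-comm)
  open import Algebra.Properties.AbelianGroup +-abelianGroup
    using (x∙y⁻¹≈ε⇒x≈y; x≈y⇒x∙y⁻¹≈ε)
  open import Algebra.Properties.Semiring.Mult semiring
    using (×-homo-+; ×-comm-*; ×-assoc-*; ×-cong)
  open import Algebra.Properties.Semiring.Exp semiring using (^-homo-*)
  open import Algebra.Properties.CommutativeSemigroup +-commutativeSemigroup
    using (interchange; x∙yz≈y∙xz)
  open CommutativeMonoidSolver *-commutativeMonoid using (solve; _⊕_; _⊜_)

  *-zeroˡ-≈ : ∀ {x} y → x ≈ 0# → x * y ≈ 0#
  *-zeroˡ-≈ y x≈0 = trans (*-congʳ x≈0) (zeroˡ y)

  *-zeroʳ-≈ : ∀ x {y} → y ≈ 0# → x * y ≈ 0#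
  *-zeroʳ-≈ x y≈0 = trans (*-congˡ y≈0) (zeroʳ x)

  *-cancelˡ-nonzero : ∀ {a x y} → ¬ (a ≈ 0#) → a * x ≈ a * y → x ≈ y
  *-cancelˡ-nonzero {a} {x} {y} a≉0 ax≈ay = begin
    x                 ≈⟨ sym (*-identityˡ x) ⟩
    1# * x            ≈⟨ *-congʳ (sym (trans (*-comm a⁻¹ a) (inverseʳ a a≉0))) ⟩
    (a⁻¹ * a) * x     ≈⟨ *-assoc a⁻¹ a x ⟩
    a⁻¹ * (a * x)     ≈⟨ *-congˡ ax≈ay ⟩
    a⁻¹ * (a * y)     ≈⟨ sym (*-assoc a⁻¹ a y) ⟩
    (a⁻¹ * a) * y     ≈⟨ *-congʳ (trans (*-comm a⁻¹ a) (inverseʳ a a≉0)) ⟩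
    1# * y            ≈⟨ *-identityˡ y ⟩
    y                 ∎
    where a⁻¹ = inverse a a≉0

  *-nonzero : ∀ {a b} → ¬ (a ≈ 0#) → ¬ (b ≈ 0#) → ¬ (a * b ≈ 0#)
  *-nonzero {a} {b} a≉0 b≉0 ab≈0 =
    b≉0 (*-cancelˡ-nonzero a≉0 (trans ab≈0 (sym (zeroʳ a))))

  ^-nonzero : ∀ {a} → ¬ (a ≈ 0#) → ∀ k → ¬ (a ^ k ≈ 0#)
  ^-nonzero a≉0 zero    = 1≉0
  ^-nonzero a≉0 (suc k) = *-nonzero a≉0 (^-nonzero a≉0 k)

  ^-cancel-∸ : ∀ {a s t n k} → ¬ (a ≈ 0#) → k ≤ n →
               a ^ n * s ≈ a ^ k * t → a ^ (n ∸ k) * s ≈ t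
  ^-cancel-∸ {a} {s} {t} {n} {k} a≉0 k≤n eq = *-cancelˡ-nonzero (^-nonzero a≉0 k) (begin
    a ^ k * (a ^ (n ∸ k) * s)  ≈⟨ sym (*-assoc _ _ s) ⟩
    a ^ k * a ^ (n ∸ k) * s    ≈⟨ *-congʳ (sym (^-homo-* a k (n ∸ k))) ⟩
    a ^ (k ℕ.+ (n ∸ k)) * s    ≡⟨ ≡.cong (λ e → a ^ e * s) (ℕ.m+[n∸m]≡n k≤n) ⟩
    a ^ n * s                  ≈⟨ eq ⟩
    a ^ k * t                  ∎)

  ×≈ι* : ∀ d x → d × x ≈ ι d * x
  ×≈ι* d x = sym (trans (×-assoc-* d 1# x) (×-cong {d} ≡.refl (*-identityˡ x)))

  ×-nonzero : ∀ {x} → ¬ (x ≈ 0#) → ∀ d → ¬ (suc d × x ≈ 0#)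
  ×-nonzero x≉0 d dx≈0 = *-nonzero (char0 d) x≉0 (trans (sym (×≈ι* (suc d) _)) dx≈0)

  ×-∸-distrib : ∀ x {i j} → i ≤ j → j × x - i × x ≈ (j ∸ i) × x
  ×-∸-distrib x {i} {j} i≤j = begin
    j × x - i × x                  ≡⟨ ≡.cong (λ e → e × x - i × x) (≡.sym (ℕ.m∸n+n≡m i≤j)) ⟩
    (j ∸ i ℕ.+ i) × x - i × x      ≈⟨ +-congʳ (×-homo-+ x (j ∸ i) i) ⟩
    ((j ∸ i) × x + i × x) - i × x  ≈⟨ +-assoc _ _ _ ⟩
    (j ∸ i) × x + (i × x - i × x)  ≈⟨ +-congˡ (-‿inverseʳ _) ⟩
    (j ∸ i) × x + 0#               ≈⟨ +-identityʳ _ ⟩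
    (j ∸ i) × x                    ∎

  sumTo-cong : ∀ n {f g : ℕ → Carrier} → (∀ i → i ≤ n → f i ≈ g i) → sumTo n f ≈ sumTo n g
  sumTo-cong zero    f≈g = f≈g 0 z≤n
  sumTo-cong (suc n) f≈g =
    +-cong (sumTo-cong n (λ i i≤n → f≈g i (ℕ.m≤n⇒m≤1+n i≤n))) (f≈g (suc n) ℕ.≤-refl)

  sumTo-+ : ∀ n (f g : ℕ → Carrier) → sumTo n (λ i → f i + g i) ≈ sumTo n f + sumTo n g
  sumTo-+ zero    f g = refl
  sumTo-+ (suc n) f g = trans (+-congʳ (sumTo-+ n f g)) (interchange _ _ _ _)

  sumTo-neg : ∀ n (f : ℕ → Carrier) → sumTo n (λ i → - f i) ≈ - sumTo n f
  sumTo-neg zero    f = refl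
  sumTo-neg (suc n) f = trans (+-congʳ (sumTo-neg n f)) (-‿+-comm _ _)

  sumTo-sub : ∀ n (f g : ℕ → Carrier) → sumTo n (λ i → f i - g i) ≈ sumTo n f - sumTo n g
  sumTo-sub n f g = trans (sumTo-+ n f (λ i → - g i)) (+-congˡ (sumTo-neg n g))

  *-distribˡ-sumTo : ∀ n a (f : ℕ → Carrier) → a * sumTo n f ≈ sumTo n (λ i → a * f i)
  *-distribˡ-sumTo zero    a f = refl
  *-distribˡ-sumTo (suc n) a f = trans (distribˡ a _ _) (+-congʳ (*-distribˡ-sumTo n a f))

  *-distribʳ-sumTo : ∀ n a (f : ℕ → Carrier) → sumTo n f * a ≈ sumTo n (λ i → f i * a)
  *-distribʳ-sumTo zero    a f = refl
  *-distribʳ-sumTo (suc n) a f = trans (distribʳ a _ _) (+-congʳ (*-distribʳ-sumTo n a f))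

  sumTo-zero : ∀ n (f : ℕ → Carrier) → (∀ i → i ≤ n → f i ≈ 0#) → sumTo n f ≈ 0#
  sumTo-zero zero    f f≈0 = f≈0 0 z≤n
  sumTo-zero (suc n) f f≈0 =
    trans (+-cong (sumTo-zero n f (λ i i≤n → f≈0 i (ℕ.m≤n⇒m≤1+n i≤n))) (f≈0 (suc n) ℕ.≤-refl))
          (+-identityʳ 0#)

  sumTo-single : ∀ n j (f : ℕ → Carrier) → j ≤ n →
                 (∀ i → i ≤ n → i ≢ j → f i ≈ 0#) → sumTo n f ≈ f j
  sumTo-single zero    .zero f z≤n _  = refl
  sumTo-single (suc n) j f j≤1+n f≈0 with ℕ.m≤n⇒m<n∨m≡n j≤1+n
  ... | inj₁ j<1+n = trans
    (+-cong (sumTo-single n j f (ℕ.≤-pred j<1+n) (λ i i≤n → f≈0 i (ℕ.m≤n⇒m≤1+n i≤n)))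
            (f≈0 (suc n) ℕ.≤-refl (ℕ.>⇒≢ j<1+n)))
    (+-identityʳ _)
  ... | inj₂ ≡.refl = trans
    (+-congʳ (sumTo-zero n f (λ i i≤n → f≈0 i (ℕ.m≤n⇒m≤1+n i≤n) (ℕ.<⇒≢ (s≤s i≤n)))))
    (+-identityˡ _)

  sumTo-suc : ∀ n (f : ℕ → Carrier) → sumTo (suc n) f ≈ f 0 + sumTo n (λ i → f (suc i))
  sumTo-suc zero    f = refl
  sumTo-suc (suc n) f = trans (+-congʳ (sumTo-suc n f)) (+-assoc _ _ _)

  sumTo-comm : ∀ n N (f : ℕ → ℕ → Carrier) →
               sumTo n (λ i → sumTo N (f i)) ≈ sumTo N (λ k → sumTo n (λ i → f i k))
  sumTo-comm zero    N f = refl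
  sumTo-comm (suc n) N f =
    trans (+-congʳ (sumTo-comm n N f)) (sym (sumTo-+ N (λ k → sumTo n (λ i → f i k)) (f (suc n))))

  sumTo-drop-zeros : ∀ k j (f : ℕ → Carrier) → (∀ i → i < k → f i ≈ 0#) →
                  sumTo (k ℕ.+ j) f ≈ sumTo j (λ i → f (k ℕ.+ i))
  sumTo-drop-zeros k zero    f f≈0 rewrite ℕ.+-identityʳ k =
    sumTo-single k k f ℕ.≤-refl (λ i i≤k i≢k → f≈0 i (ℕ.≤∧≢⇒< i≤k i≢k))
  sumTo-drop-zeros k (suc j) f f≈0 rewrite ℕ.+-suc k j = +-congʳ (sumTo-drop-zeros k j f f≈0)

  sumTo≈sumFromTo : ∀ k n (f : ℕ → Carrier) → k ≤ n → (∀ i → i < k → f i ≈ 0#) →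
                    sumTo n f ≈ sumFromTo k n f
  sumTo≈sumFromTo k n f k≤n f≈0 =
    ≡.subst (λ t → sumTo t f ≈ sumFromTo k n f) (ℕ.m+[n∸m]≡n k≤n) (sumTo-drop-zeros k (n ∸ k) f f≈0)

  binom-< : ∀ {n k} → n < k → binom n k ≈ 0#
  binom-< n<k = reflexive (≡.cong ι (k>n⇒nCk≡0 n<k))

  binom-0 : ∀ n → binom n 0 ≈ 1#
  binom-0 n = trans (reflexive (≡.cong ι (≡.trans (nCk≡nC[n∸k] {0} {n} z≤n) (nCn≡1 n))))
                    (+-identityʳ 1#)

  binom-suc-suc : ∀ n k → binom (suc n) (suc k) ≈ binom n k + binom n (suc k)
  binom-suc-suc n k = trans (reflexive (≡.cong ι (≡.sym (nCk+nC[k+1]≡[n+1]C[k+1] n k))))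
                            (×-homo-+ 1# (n C k) _)

  binom-*-*-vanishes : ∀ {n k x y} → n < k → binom n k * x * y ≈ 0#
  binom-*-*-vanishes n<k = *-zeroˡ-≈ _ (*-zeroˡ-≈ _ (binom-< n<k))

  fall-vanishes : ∀ μ x {i} k → i < k → x ≈ i × μ → fall x k μ ≈ 0#
  fall-vanishes μ x (suc k) i<1+k x≈iμ with ℕ.m<1+n⇒m<n∨m≡n i<1+k
  ... | inj₁ i<k     = *-zeroˡ-≈ _ (fall-vanishes μ x k i<k x≈iμ)
  ... | inj₂ ≡.refl  = *-zeroʳ-≈ _ (x≈y⇒x∙y⁻¹≈ε x≈iμ)

  fall-nonzero : ∀ {μ} → ¬ (μ ≈ 0#) → ∀ j k → k ≤ j → ¬ (fall (j × μ) k μ ≈ 0#)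
  fall-nonzero μ≉0 j zero    _     = 1≉0
  fall-nonzero {μ} μ≉0 j (suc k) 1+k≤j =
    *-nonzero (fall-nonzero μ≉0 j k (ℕ.<⇒≤ 1+k≤j)) last≉0
    where
      last≉0 : ¬ (j × μ - k × μ ≈ 0#)
      last≉0 last≈0 = ×-nonzero μ≉0 (j ∸ suc k) (begin
        suc (j ∸ suc k) × μ  ≡⟨ ≡.cong (_× μ) (≡.sym (ℕ.+-∸-assoc 1 1+k≤j)) ⟩
        (j ∸ k) × μ          ≈⟨ ×-∸-distrib μ (ℕ.<⇒≤ 1+k≤j) ⟨
        j × μ - k × μ        ≈⟨ last≈0 ⟩
        0#                   ∎)

  fall-independent : ∀ {μ} → ¬ (μ ≈ 0#) → ∀ n (a : ℕ → Carrier) →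
                     (∀ x → sumTo n (λ k → a k * fall x k μ) ≈ 0#) → ∀ k → k ≤ n → a k ≈ 0#
  fall-independent {μ} μ≉0 n a vanishes = <-rec (λ j → j ≤ n → a j ≈ 0#) step
    where
      step : ∀ j → (∀ {i} → i < j → i ≤ n → a i ≈ 0#) → j ≤ n → a j ≈ 0#
      step j below j≤n = *-cancelˡ-nonzero (fall-nonzero μ≉0 j j ℕ.≤-refl) (begin
        fall (j × μ) j μ * a j  ≈⟨ *-comm _ _ ⟩
        a j * fall (j × μ) j μ  ≈⟨ sumTo-single n j _ j≤n others ⟨
        sumTo n (λ k → a k * fall (j × μ) k μ)  ≈⟨ vanishes (j × μ) ⟩
        0#                                      ≈⟨ zeroʳ _ ⟨
        fall (j × μ) j μ * 0#   ∎)
        where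
          others : ∀ i → i ≤ n → i ≢ j → a i * fall (j × μ) i μ ≈ 0#
          others i i≤n i≢j with ℕ.<-cmp i j
          ... | tri< i<j _ _ = *-zeroˡ-≈ _ (below i<j i≤n)
          ... | tri≈ _ i≡j _ = ⊥-elim (i≢j i≡j)
          ... | tri> _ _ j<i = *-zeroʳ-≈ _ (fall-vanishes μ (j × μ) i j<i refl)

  fall-coefficients-unique :
    ∀ {μ} → ¬ (μ ≈ 0#) → ∀ n (a b : ℕ → Carrier) →
    (∀ x → sumTo n (λ k → a k * fall x k μ) ≈ sumTo n (λ k → b k * fall x k μ)) →
    ∀ k → k ≤ n → a k ≈ b k
  fall-coefficients-unique {μ} μ≉0 n a b same k k≤n =
    x∙y⁻¹≈ε⇒x≈y (a k) (b k) (fall-independent μ≉0 n (λ k → a k - b k) difference k k≤n)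
    where
      difference : ∀ x → sumTo n (λ k → (a k - b k) * fall x k μ) ≈ 0#
      difference x = begin
        sumTo n (λ k → (a k - b k) * fall x k μ)
          ≈⟨ sumTo-cong n (λ k _ → trans (distribʳ _ _ _) (+-congˡ (sym (-‿distribˡ-* _ _)))) ⟩
        sumTo n (λ k → a k * fall x k μ - b k * fall x k μ)
          ≈⟨ sumTo-sub n _ _ ⟩
        sumTo n (λ k → a k * fall x k μ) - sumTo n (λ k → b k * fall x k μ)
          ≈⟨ x≈y⇒x∙y⁻¹≈ε (same x) ⟩
        0# ∎

  fall-scale : ∀ {s μ ν} → ν ≈ s * μ → ∀ x k → fall (s * x) k ν ≈ s ^ k * fall x k μ
  fall-scale ν≈sμ x zero    = sym (*-identityʳ 1#)
  fall-scale {s} {μ} {ν} ν≈sμ x (suc k) = trans (*-cong (fall-scale ν≈sμ x k) factor) (regroup _ _ _ _)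
    where
      factor : s * x - k × ν ≈ s * (x - k × μ)
      factor = begin
        s * x - k × ν          ≈⟨ +-congˡ (-‿cong (×-cong {k} ≡.refl ν≈sμ)) ⟩
        s * x - k × (s * μ)    ≈⟨ +-congˡ (-‿cong (×-comm-* k s μ)) ⟨
        s * x - s * (k × μ)    ≈⟨ +-congˡ (-‿distribʳ-* s _) ⟩
        s * x + s * - (k × μ)  ≈⟨ distribˡ s x _ ⟨
        s * (x - k × μ)        ∎
      regroup : ∀ a b c d → (a * b) * (c * d) ≈ (c * a) * (b * d)
      regroup = solve 4 (λ a b c d → (a ⊕ b) ⊕ (c ⊕ d) ⊜ (c ⊕ a) ⊕ (b ⊕ d)) refl

  module _ (a b l : Carrier) where
    private
      term : ℕ → ℕ → Carrier
      term n k = binom n k * fall a k l * fall b (n ∸ k) l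

      termˡ : ℕ → ℕ → Carrier
      termˡ n k = binom n k * fall a (suc k) l * fall b (n ∸ k) l

      termʳ : ℕ → ℕ → Carrier
      termʳ n k = binom n k * fall a k l * fall b (suc n ∸ k) l

      factor-split : ∀ n k → k ≤ n → (a + b) - n × l ≈ (a - k × l) + (b - (n ∸ k) × l)
      factor-split n k k≤n = begin
        (a + b) - n × l                    ≡⟨ ≡.cong (λ e → (a + b) - e × l) (≡.sym (ℕ.m+[n∸m]≡n k≤n)) ⟩
        (a + b) - (k ℕ.+ (n ∸ k)) × l      ≈⟨ +-congˡ (-‿cong (×-homo-+ l k (n ∸ k))) ⟩
        (a + b) - (k × l + (n ∸ k) × l)    ≈⟨ +-congˡ (-‿+-comm _ _) ⟨
        (a + b) + (- (k × l) + - ((n ∸ k) × l))  ≈⟨ interchange a b _ _ ⟩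
        (a - k × l) + (b - (n ∸ k) × l)    ∎

      term-step : ∀ n k → term n k * ((a + b) - n × l) ≈ termˡ n k + termʳ n k
      term-step n k with k ℕ.≤? n
      ... | yes k≤n = begin
        term n k * ((a + b) - n × l)                      ≈⟨ *-congˡ (factor-split n k k≤n) ⟩
        term n k * ((a - k × l) + (b - (n ∸ k) × l))      ≈⟨ distribˡ _ _ _ ⟩
        term n k * (a - k × l) + term n k * (b - (n ∸ k) × l)  ≈⟨ +-cong raiseˡ raiseʳ ⟩
        termˡ n k + termʳ n k                             ∎
        where
          raiseˡ : term n k * (a - k × l) ≈ termˡ n k
          raiseˡ = solve 4 (λ c x y z → ((c ⊕ x) ⊕ y) ⊕ z ⊜ (c ⊕ (x ⊕ z)) ⊕ y) refl _ _ _ _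
          raiseʳ : term n k * (b - (n ∸ k) × l) ≈ termʳ n k
          raiseʳ = trans (*-assoc _ _ _)
                         (*-congˡ (reflexive (≡.cong (λ e → fall b e l) (≡.sym (ℕ.+-∸-assoc 1 k≤n)))))
      ... | no k≰n = begin
        term n k * ((a + b) - n × l)  ≈⟨ *-zeroˡ-≈ _ (binom-*-*-vanishes n<k) ⟩
        0#                            ≈⟨ +-identityʳ 0# ⟨
        0# + 0#                       ≈⟨ +-cong (binom-*-*-vanishes n<k) (binom-*-*-vanishes n<k) ⟨
        termˡ n k + termʳ n k         ∎
        where n<k = ℕ.≰⇒> k≰n

      term-suc-suc : ∀ n k → term (suc n) (suc k) ≈ termˡ n k + termʳ n (suc k)
      term-suc-suc n k =
        trans (*-congʳ (trans (*-congʳ (binom-suc-suc n k)) (distribʳ _ _ _))) (distribʳ _ _ _)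

      termʳ-zero : ∀ n → termʳ n 0 ≈ term (suc n) 0
      termʳ-zero n = *-congʳ (*-congʳ (trans (binom-0 n) (sym (binom-0 (suc n)))))

      term-zero : term 0 0 ≈ 1#
      term-zero = trans (*-identityʳ _) (trans (*-identityʳ _) (binom-0 0))

    -- Summing to any N ≥ n (the terms with k > n vanish) lets the expansions of
    -- all (a + b)_{i,l} with i ≤ N share one range of summation.
    fall-+ : ∀ n N → n ≤ N →
             fall (a + b) n l ≈ sumTo N (λ k → binom n k * fall a k l * fall b (n ∸ k) l)
    fall-+ zero N _ = sym (trans (sumTo-single N 0 (term 0) z≤n others) term-zero)
      where
        others : ∀ i → i ≤ N → i ≢ 0 → term 0 i ≈ 0#
        others zero    _ 0≢0 = ⊥-elim (0≢0 ≡.refl)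
        others (suc i) _ _   = binom-*-*-vanishes {0} {suc i} (s≤s z≤n)
    fall-+ (suc n) (suc N) (s≤s n≤N) = begin
      fall (a + b) n l * W
        ≈⟨ *-congʳ (fall-+ n (suc N) (ℕ.m≤n⇒m≤1+n n≤N)) ⟩
      sumTo (suc N) (term n) * W
        ≈⟨ *-distribʳ-sumTo (suc N) W (term n) ⟩
      sumTo (suc N) (λ k → term n k * W)
        ≈⟨ sumTo-cong (suc N) (λ k _ → term-step n k) ⟩
      sumTo (suc N) (λ k → termˡ n k + termʳ n k)
        ≈⟨ sumTo-+ (suc N) (termˡ n) (termʳ n) ⟩
      (sumTo N (termˡ n) + termˡ n (suc N)) + sumTo (suc N) (termʳ n)
        ≈⟨ +-cong (+-congˡ (binom-*-*-vanishes (s≤s n≤N))) (sumTo-suc N (termʳ n)) ⟩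
      (sumTo N (termˡ n) + 0#) + (termʳ n 0 + sumTo N (λ k → termʳ n (suc k)))
        ≈⟨ regroup _ _ _ ⟩
      termʳ n 0 + (sumTo N (termˡ n) + sumTo N (λ k → termʳ n (suc k)))
        ≈⟨ +-cong (termʳ-zero n) (sumTo-+ N (termˡ n) (λ k → termʳ n (suc k))) ⟨
      term (suc n) 0 + sumTo N (λ k → termˡ n k + termʳ n (suc k))
        ≈⟨ +-congˡ (sumTo-cong N (λ k _ → term-suc-suc n k)) ⟨
      term (suc n) 0 + sumTo N (λ k → term (suc n) (suc k))
        ≈⟨ sumTo-suc N (term (suc n)) ⟨
      sumTo (suc N) (term (suc n)) ∎
      where
        W = (a + b) - n × l
        regroup : ∀ x y z → (x + 0#) + (y + z) ≈ y + (x + z)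
        regroup x y z = trans (+-congʳ (+-identityʳ x)) (x∙yz≈y∙xz x y z)

  fall-shift-expansion :
    ∀ {s μ ν} → ν ≈ s * μ → ∀ n (v : ℕ → Carrier) x y →
    sumTo n (λ i → v i * fall (s * x + y) i ν) ≈
    sumTo n (λ k → (s ^ k * sumTo n (λ i → binom i k * v i * fall y (i ∸ k) ν)) * fall x k μ)
  fall-shift-expansion {s} {μ} {ν} ν≈sμ n v x y = begin
    sumTo n (λ i → v i * fall (s * x + y) i ν)
      ≈⟨ sumTo-cong n expand ⟩
    sumTo n (λ i → sumTo n (λ k → (s ^ k * coefficient k i) * fall x k μ))
      ≈⟨ sumTo-comm n n (λ i k → (s ^ k * coefficient k i) * fall x k μ) ⟩
    sumTo n (λ k → sumTo n (λ i → (s ^ k * coefficient k i) * fall x k μ))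
      ≈⟨ sumTo-cong n (λ k _ → collect k) ⟩
    sumTo n (λ k → (s ^ k * sumTo n (coefficient k)) * fall x k μ) ∎
    where
      coefficient : ℕ → ℕ → Carrier
      coefficient k i = binom i k * v i * fall y (i ∸ k) ν

      regroup : ∀ w c p x o → w * (c * (p * x) * o) ≈ (p * (c * w * o)) * x
      regroup = solve 5 (λ w c p x o → w ⊕ ((c ⊕ (p ⊕ x)) ⊕ o) ⊜ (p ⊕ ((c ⊕ w) ⊕ o)) ⊕ x) refl

      expand : ∀ i → i ≤ n →
               v i * fall (s * x + y) i ν ≈ sumTo n (λ k → (s ^ k * coefficient k i) * fall x k μ)
      expand i i≤n = begin
        v i * fall (s * x + y) i ν
          ≈⟨ *-congˡ (fall-+ (s * x) y ν i n i≤n) ⟩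
        v i * sumTo n (λ k → binom i k * fall (s * x) k ν * fall y (i ∸ k) ν)
          ≈⟨ *-distribˡ-sumTo n (v i) _ ⟩
        sumTo n (λ k → v i * (binom i k * fall (s * x) k ν * fall y (i ∸ k) ν))
          ≈⟨ sumTo-cong n (λ k _ → *-congˡ (*-congʳ (*-congˡ (fall-scale ν≈sμ x k)))) ⟩
        sumTo n (λ k → v i * (binom i k * (s ^ k * fall x k μ) * fall y (i ∸ k) ν))
          ≈⟨ sumTo-cong n (λ k _ → regroup _ _ _ _ _) ⟩
        sumTo n (λ k → (s ^ k * coefficient k i) * fall x k μ) ∎

      collect : ∀ k → sumTo n (λ i → (s ^ k * coefficient k i) * fall x k μ)
                      ≈ (s ^ k * sumTo n (coefficient k)) * fall x k μ
      collect k = sym (trans (*-congʳ (*-distribˡ-sumTo n (s ^ k) (coefficient k)))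
                             (*-distribʳ-sumTo n (fall x k μ) _))

  ι-*-divBy : ∀ μ m (1≤m : 1 ≤ m) → ι m * divBy μ m 1≤m ≈ μ
  ι-*-divBy μ m 1≤m = begin
    ι m * (μ * m⁻¹)  ≈⟨ *-comm _ _ ⟩
    (μ * m⁻¹) * ι m  ≈⟨ *-assoc _ _ _ ⟩
    μ * (m⁻¹ * ι m)  ≈⟨ *-congˡ (trans (*-comm _ _) (inverseʳ _ _)) ⟩
    μ * 1#           ≈⟨ *-identityʳ μ ⟩
    μ                ∎
    where m⁻¹ = inverse (ι m) (ι-nonzero m 1≤m)

  divBy-nonzero : ∀ {μ} → ¬ (μ ≈ 0#) → ∀ m (1≤m : 1 ≤ m) → ¬ (divBy μ m 1≤m ≈ 0#)
  divBy-nonzero μ≉0 m 1≤m μ/m≈0 =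
    μ≉0 (trans (sym (ι-*-divBy _ m 1≤m)) (*-zeroʳ-≈ (ι m) μ/m≈0))

theorem20 : {c ℓ : Level} (F : CharZeroField c ℓ) →
    let open CharZeroField F
        open Ops F
    in (m : ℕ) (hm : 1 ≤ m) (lam : Carrier) → ¬ (lam ≈ 0#) →
       (S : ℕ → ℕ → Carrier) →
       (∀ n x → fall x n 1# ≈ sumTo n (λ l → S n l * fall x l (divBy lam m hm))) →
       (V : ℕ → ℕ → Carrier) →
       (∀ n x → ι m ^ n * fall x n 1# ≈ sumTo n (λ k → V n k * fall (ι m * x + 1#) k lam)) →
       ∀ n k → k ≤ n →
       ι m ^ (n ∸ k) * S n k ≈ sumFromTo k n (λ i → binom i k * V n i * fall 1# (i ∸ k) lam)
theorem20 F m hm lam lam≉0 S hS V hV n k k≤n =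
  ^-cancel-∸ (ι-nonzero m hm) k≤n (begin
    ι m ^ n * S n k                          ≈⟨ same-coefficients k k≤n ⟩
    ι m ^ k * sumTo n (coefficient k)        ≈⟨ *-congˡ (sumTo≈sumFromTo k n (coefficient k) k≤n
                                                          (λ _ → binom-*-*-vanishes)) ⟩
    ι m ^ k * sumFromTo k n (coefficient k)  ∎)
  where
    open CharZeroField F hiding (zero)
    open Ops F
    open Development F
    open import Relation.Binary.Reasoning.Setoid setoid

    μ : Carrier
    μ = divBy lam m hm

    coefficient : ℕ → ℕ → Carrier
    coefficient k i = binom i k * V n i * fall 1# (i ∸ k) lam

    expansionˢ : ∀ x → ι m ^ n * fall x n 1# ≈ sumTo n (λ k → (ι m ^ n * S n k) * fall x k μ)
    expansionˢ x = trans (*-congˡ (hS n x))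
      (trans (*-distribˡ-sumTo n (ι m ^ n) _) (sumTo-cong n (λ k _ → sym (*-assoc _ _ _))))

    expansionᵛ : ∀ x → ι m ^ n * fall x n 1# ≈ sumTo n (λ k → (ι m ^ k * sumTo n (coefficient k)) * fall x k μ)
    expansionᵛ x = trans (hV n x) (fall-shift-expansion (sym (ι-*-divBy lam m hm)) n (V n) x 1#)

    same-coefficients : ∀ k → k ≤ n → ι m ^ n * S n k ≈ ι m ^ k * sumTo n (coefficient k)
    same-coefficients = fall-coefficients-unique (divBy-nonzero lam≉0 m hm) n _ _
      (λ x → trans (sym (expansionˢ x)) (expansionᵛ x))
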